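{- Let $\pi\in\mathfrak{B}_n$. For every grid point $(i,j)$ with $1\le i,j\le n+1$, both $d^+(i,j)$ and $d^-(i,j)$ belong to $\{(0,0),(1,0),(0,1),(1,1)\}$.
   Context: $\mathfrak{B}_n$ is the set of signed permutations $\pi=\pi_1\cdots\pi_n$ ($\pi_i\in\{\pm1,\dots,\pm n\}$, $|\pi_1|,\dots,|\pi_n|$ a permutation of $[n]$), $\pi_0=0$, inverse given by $\pi^{ -1}_{|\pi_i|}=\operatorname{sgn}(\pi_i)\,i$. Natural order: $\operatorname{des}^B(\pi)=|\{i\in\{0,\dots,n-1\}:\pi_i>\pi_{i+1}\}|$, $\operatorname{ides}^B(\pi)=\operatorname{des}^B(\pi^{ -1})$. For $i,j\in[n+1]$, $\varphi_{(i,j)}(\pi)$ is the $\sigma\in\mathfrak{B}_{n+1}$ with $\sigma_i=j$, $\sigma_k=s(\pi_k)$ for $k<i$, $\sigma_k=s(\pi_{k-1})$ for $k>i$, where $s(x)=x$ if $|x|<j$, $s(x)=x+1$ if $x\ge j$, $s(x)=x-1$ if $x\le-j$; $\overline{\varphi}_{(i,j)}(\pi)$ is the same but with $\sigma_i=-j$. The $d^+$-type of the grid point $(i,j)$ is $d^+(i,j)=\big(\operatorname{des}^B(\varphi_{(i,j)}(\pi))-\operatorname{des}^B(\pi),\ \operatorname{ides}^B(\varphi_{(i,j)}(\pi))-\operatorname{ides}^B(\pi)\big)$, and the $d^-$-type $d^-(i,j)$ is defined the same way with $\overline{\varphi}_{(i,j)}$. -}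

module Defs where

open import Data.Nat using (ℕ; zero; suc; _≤_; _<?_; _≟_; _∸_)
import Data.Nat as ℕ
open import Data.Integer as ℤ using (ℤ; +_; -_; ∣_∣; _-_; _+_; _*_; 0ℤ; 1ℤ)
open import Data.List using (List; []; _∷_; map; take; drop; length; _++_; upTo)
open import Data.List.Relation.Unary.All using (All)
open import Data.List.Relation.Unary.Unique.Propositional using (Unique)
open import Data.Product using (_×_; _,_)
open import Data.Sum using (_⊎_)
open import Relation.Binary.PropositionalEquality using (_≡_)
open import Relation.Nullary.Decidable using (does)
open import Data.Bool using (if_then_else_)

IsSignedPerm : ℕ → List ℤ → Set
IsSignedPerm n π =
  (length π ≡ n) × All (λ x → (1 ≤ ∣ x ∣) × (∣ x ∣ ≤ n)) π × Unique (map ∣_∣ π)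

descents : List ℤ → ℕ
descents []           = 0
descents (x ∷ [])     = 0
descents (x ∷ y ∷ xs) = (if does (y ℤ.<? x) then 1 else 0) ℕ.+ descents (y ∷ xs)

desB : List ℤ → ℕ
desB π = descents (0ℤ ∷ π)

sgn : ℤ → ℤ
sgn x = if does (0ℤ ℤ.≤? x) then 1ℤ else - 1ℤ

-- find the position i (1-based, starting the count at `pos`) with |π_i| = k,
-- returning sgn(π_i)·i (0 if no such position; never happens for signed perms)
invEntry : ℕ → List ℤ → ℕ → ℤ
invEntry k []      pos = 0ℤ
invEntry k (x ∷ xs) pos =
  if does (∣ x ∣ ≟ k) then sgn x * (+ pos) else invEntry k xs (suc pos)

-- inverse of a signed permutation of [n]: π⁻¹_{|π_i|} = sgn(π_i)·i
invB : ℕ → List ℤ → List ℤ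
invB n π = map (λ k → invEntry (suc k) π 1) (upTo n)

ides : ℕ → List ℤ → ℕ
ides n π = desB (invB n π)

shift : ℕ → ℤ → ℤ
shift j x =
  if does (∣ x ∣ <? j) then x
  else (if does (0ℤ ℤ.≤? x) then x + 1ℤ else x - 1ℤ)

insertAt : ℕ → ℕ → ℤ → List ℤ → List ℤ
insertAt i j v π = map (shift j) (take (i ∸ 1) π) ++ (v ∷ map (shift j) (drop (i ∸ 1) π))

φ : ℕ → ℕ → List ℤ → List ℤ
φ i j π = insertAt i j (+ j) π

φ̄ : ℕ → ℕ → List ℤ → List ℤ
φ̄ i j π = insertAt i j (- (+ j)) π

dPlus : ℕ → List ℤ → ℕ → ℕ → ℤ × ℤ
dPlus n π i j =
  ( (+ desB (φ i j π)) - (+ desB π)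
  , (+ ides (suc n) (φ i j π)) - (+ ides n π) )

dMinus : ℕ → List ℤ → ℕ → ℕ → ℤ × ℤ
dMinus n π i j =
  ( (+ desB (φ̄ i j π)) - (+ desB π)
  , (+ ides (suc n) (φ̄ i j π)) - (+ ides n π) )

AllowedType : ℤ × ℤ → Set
AllowedType d =
  (d ≡ (0ℤ , 0ℤ)) ⊎ (d ≡ (1ℤ , 0ℤ)) ⊎ (d ≡ (0ℤ , 1ℤ)) ⊎ (d ≡ (1ℤ , 1ℤ))

-- Inserting a letter v between p and r of a word changes its descent count by
-- [p > v] + [v > r] − [p > r] ∈ {0, 1}, and relabelling the other letters by a
-- strictly increasing map changes nothing. The word 0φ(π) is such an insertion
-- into 0π, as s is strictly increasing and fixes 0. Its inverse is one too:
-- φ_(i,j)(π)⁻¹ arises from π⁻¹ by inserting ±i at position j and relabelling the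
-- other entries by the shift relative to i. So both desB and ides grow by 0 or 1.
module Submission where

open import Defs
open import Data.Bool using (true; false; if_then_else_)
open import Data.Integer as ℤ using (ℤ; +_; -[1+_]; 0ℤ; 1ℤ; ∣_∣; sign; _◃_; +<+; -<+; -<-)
import Data.Integer.Properties as ℤP
open import Data.List using (List; []; _∷_; _++_; map; take; drop; length; applyUpTo)
open import Data.List.Properties using (map-++; take++drop≡id; length-map; length-take; map-upTo)
open import Data.Nat as ℕ using (ℕ; zero; suc; _∸_; _<ᵇ_; _≡ᵇ_; _≟_; s≤s; z≤n; NonZero)
import Data.Nat.Properties as ℕP
open import Data.Product using (_×_; _,_; ∃-syntax)
import Data.Sign as Sign
open import Data.Sum using (_⊎_; inj₁; inj₂)
open import Function.Base using (_∘_)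
open import Function.Bundles using (_⇔_; mk⇔)
open import Relation.Binary.Core using (_Preserves_⟶_)
open import Relation.Binary.Definitions using (tri<; tri≈; tri>)
open import Relation.Binary.PropositionalEquality
open import Relation.Nullary using (yes; no; does; proof; contradiction)
open import Relation.Nullary.Decidable using (does-⇔)
open import Relation.Nullary.Reflects using (ofʸ; ofⁿ)

bump : ℕ → ℕ → ℕ
bump j m = if m <ᵇ j then m else suc m

bump-below : ∀ {j m} → m ℕ.< j → bump j m ≡ m
bump-below {j} {m} m<j with m <ᵇ j | ℕP.<ᵇ-reflects-< m j
... | true  | _        = refl
... | false | ofⁿ m≮j = contradiction m<j m≮j

bump-above : ∀ {j m} → j ℕ.≤ m → bump j m ≡ suc m
bump-above {j} {m} j≤m with m <ᵇ j | ℕP.<ᵇ-reflects-< m j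
... | true  | ofʸ m<j = contradiction m<j (ℕP.≤⇒≯ j≤m)
... | false | _       = refl

bump-mono-< : ∀ j → bump j Preserves ℕ._<_ ⟶ ℕ._<_
bump-mono-< j {m} {n} m<n with m <ᵇ j | ℕP.<ᵇ-reflects-< m j | n <ᵇ j | ℕP.<ᵇ-reflects-< n j
... | true  | _        | true  | _       = m<n
... | true  | _        | false | _       = ℕP.m<n⇒m<1+n m<n
... | false | ofⁿ m≮j | true  | ofʸ n<j = contradiction (ℕP.<-trans m<n n<j) m≮j
... | false | _        | false | _       = s≤s m<n

bump-injective : ∀ j {m n} → bump j m ≡ bump j n → m ≡ n
bump-injective j {m} {n} eq with ℕP.<-cmp m n
... | tri< m<n _ _ = contradiction eq (ℕP.<⇒≢ (bump-mono-< j m<n))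
... | tri≈ _ m≡n _ = m≡n
... | tri> _ _ n<m = contradiction (sym eq) (ℕP.<⇒≢ (bump-mono-< j n<m))

bump≢threshold : ∀ j m → bump j m ≢ j
bump≢threshold j m with m <ᵇ j | ℕP.<ᵇ-reflects-< m j
... | true  | ofʸ m<j = ℕP.<⇒≢ m<j
... | false | ofⁿ m≮j = λ 1+m≡j → m≮j (subst (m ℕ.<_) 1+m≡j (ℕP.n<1+n m))

bump-suc-nonZero : ∀ j m → NonZero (bump j (suc m))
bump-suc-nonZero j m with suc m <ᵇ j
... | true  = ℕ.nonZero
... | false = ℕ.nonZero

shift≡sign◃bump : ∀ j x → shift j x ≡ sign x ◃ bump j ∣ x ∣
shift≡sign◃bump j (+ m) with m <ᵇ j
... | true  = sym (ℤP.+◃n≡+n m)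
... | false = cong +_ (ℕP.+-comm m 1)
shift≡sign◃bump j -[1+ m ] with suc m <ᵇ j
... | true  = refl
... | false = cong (λ k → -[1+ suc k ]) (ℕP.+-identityʳ m)

∣shift∣≡bump : ∀ j x → ∣ shift j x ∣ ≡ bump j ∣ x ∣
∣shift∣≡bump j x = trans (cong ∣_∣ (shift≡sign◃bump j x)) (ℤP.abs-◃ (sign x) _)

sgn-shift : ∀ j x → sgn (shift j x) ≡ sgn x
sgn-shift j (+ m) with m <ᵇ j
... | true  = refl
... | false = refl
sgn-shift j -[1+ m ] with suc m <ᵇ j
... | true  = refl
... | false = refl

shift-mono-< : ∀ j → shift j Preserves ℤ._<_ ⟶ ℤ._<_
shift-mono-< j {x} {y} x<y rewrite shift≡sign◃bump j x | shift≡sign◃bump j y = ◃bump-mono x<y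
  where
  ◃bump-mono : ∀ {x y} → x ℤ.< y → sign x ◃ bump j ∣ x ∣ ℤ.< sign y ◃ bump j ∣ y ∣
  ◃bump-mono (+<+ m<n) = ℤP.+◃-mono-< (bump-mono-< j m<n)
  ◃bump-mono (-<+ {m} {n}) = ℤP.-◃<+◃ (bump j (suc m)) (bump j n) {{bump-suc-nonZero j m}}
  ◃bump-mono (-<- {m} {n} n<m) rewrite ℤP.-◃n≡-n (bump j (suc m)) | ℤP.-◃n≡-n (bump j (suc n)) =
    ℤP.neg-mono-< (+<+ (bump-mono-< j (s≤s n<m)))

sgn*+≡sign◃ : ∀ x n → sgn x ℤ.* + n ≡ sign x ◃ n
sgn*+≡sign◃ (+ _)    n = cong (Sign.+ ◃_) (ℕP.*-identityˡ n)
sgn*+≡sign◃ -[1+ _ ] n = cong (Sign.- ◃_) (ℕP.*-identityˡ n)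

shift-sgn*+ : ∀ j x n .{{_ : NonZero n}} → shift j (sgn x ℤ.* + n) ≡ sgn x ℤ.* + bump j n
shift-sgn*+ j x n = begin
  shift j (sgn x ℤ.* + n)                       ≡⟨ cong (shift j) (sgn*+≡sign◃ x n) ⟩
  shift j (sign x ◃ n)                          ≡⟨ shift≡sign◃bump j (sign x ◃ n) ⟩
  sign (sign x ◃ n) ◃ bump j ∣ sign x ◃ n ∣     ≡⟨ cong₂ _◃_ (ℤP.sign-◃ (sign x) n) (cong (bump j) (ℤP.abs-◃ (sign x) n)) ⟩
  sign x ◃ bump j n                             ≡⟨ sgn*+≡sign◃ x (bump j n) ⟨
  sgn x ℤ.* + bump j n                          ∎
  where open ≡-Reasoning

ZeroOrOneAbove : ℕ → ℕ → Set
ZeroOrOneAbove a b = (a ≡ b) ⊎ (a ≡ suc b)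

+-zeroOrOneAboveˡ : ∀ c {a b} → ZeroOrOneAbove a b → ZeroOrOneAbove (c ℕ.+ a) (c ℕ.+ b)
+-zeroOrOneAboveˡ c         (inj₁ refl) = inj₁ refl
+-zeroOrOneAboveˡ c {b = b} (inj₂ refl) = inj₂ (ℕP.+-suc c b)

+-zeroOrOneAboveʳ : ∀ c {a b} → ZeroOrOneAbove a b → ZeroOrOneAbove (a ℕ.+ c) (b ℕ.+ c)
+-zeroOrOneAboveʳ c (inj₁ refl) = inj₁ refl
+-zeroOrOneAboveʳ c (inj₂ refl) = inj₂ refl

descentAt : ℤ → ℤ → ℕ
descentAt x y = if does (y ℤ.<? x) then 1 else 0

strictMono-cancel-< : ∀ {f : ℤ → ℤ} → f Preserves ℤ._<_ ⟶ ℤ._<_ → ∀ {x y} → f x ℤ.< f y → x ℤ.< y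
strictMono-cancel-< mono {x} {y} fx<fy with ℤP.<-cmp x y
... | tri< x<y _ _ = x<y
... | tri≈ _ refl _ = contradiction fx<fy (ℤP.<-irrefl refl)
... | tri> _ _ y<x = contradiction (mono y<x) (ℤP.<-asym fx<fy)

descents-map : ∀ {f : ℤ → ℤ} → f Preserves ℤ._<_ ⟶ ℤ._<_ → ∀ L → descents (map f L) ≡ descents L
descents-map     mono []          = refl
descents-map     mono (x ∷ [])    = refl
descents-map {f} mono (x ∷ y ∷ L) = cong₂ ℕ._+_ sameDescentAt (descents-map mono (y ∷ L))
  where
  sameDescentAt : descentAt (f x) (f y) ≡ descentAt x y
  sameDescentAt = cong (if_then 1 else 0) (does-⇔ (mk⇔ (strictMono-cancel-< mono) mono) (f y ℤ.<? f x) (y ℤ.<? x))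

descentAt-split : ∀ p v r → ZeroOrOneAbove (descentAt p v ℕ.+ descentAt v r) (descentAt p r)
descentAt-split p v r with v ℤ.<? p | r ℤ.<? v | r ℤ.<? p
... | yes _   | yes _   | yes _   = inj₂ refl
... | yes v<p | yes r<v | no r≮p  = contradiction (ℤP.<-trans r<v v<p) r≮p
... | yes _   | no _    | yes _   = inj₁ refl
... | yes _   | no _    | no _    = inj₂ refl
... | no _    | yes _   | yes _   = inj₁ refl
... | no _    | yes _   | no _    = inj₂ refl
... | no v≮p  | no r≮v  | yes r<p = contradiction r<p (ℤP.≤⇒≯ (ℤP.≤-trans (ℤP.≮⇒≥ v≮p) (ℤP.≮⇒≥ r≮v)))
... | no _    | no _    | no _    = inj₁ refl

descents-insert : ∀ p P v R → ZeroOrOneAbove (descents (p ∷ P ++ v ∷ R)) (descents (p ∷ P ++ R))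
descents-insert p (q ∷ P) v R       = +-zeroOrOneAboveˡ (descentAt p q) (descents-insert q P v R)
descents-insert p []      v []      with v ℤ.<? p
... | yes _ = inj₂ refl
... | no _  = inj₁ refl
descents-insert p []      v (r ∷ R) =
  subst (λ a → ZeroOrOneAbove a (descents (p ∷ r ∷ R))) (ℕP.+-assoc (descentAt p v) (descentAt v r) (descents (r ∷ R)))
    (+-zeroOrOneAboveʳ (descents (r ∷ R)) (descentAt-split p v r))

-- The threshold is positive so that the relabelling fixes π₀ = 0.
desB-insertAt : ∀ i j v L → ZeroOrOneAbove (desB (insertAt i (suc j) v L)) (desB L)
desB-insertAt i j v L = subst (ZeroOrOneAbove _) relabel (descents-insert 0ℤ (map s A) v (map s B))
  where
  s = shift (suc j)
  A = take (i ∸ 1) L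
  B = drop (i ∸ 1) L
  relabel : descents (0ℤ ∷ map s A ++ map s B) ≡ desB L
  relabel = begin
    descents (0ℤ ∷ map s A ++ map s B) ≡⟨ cong (λ X → descents (0ℤ ∷ X)) (map-++ s A B) ⟨
    descents (map s (0ℤ ∷ A ++ B))     ≡⟨ descents-map (shift-mono-< (suc j)) (0ℤ ∷ A ++ B) ⟩
    descents (0ℤ ∷ A ++ B)             ≡⟨ cong (λ X → descents (0ℤ ∷ X)) (take++drop≡id (i ∸ 1) L) ⟩
    desB L                             ∎
    where open ≡-Reasoning

invEntry-map-shift : ∀ j k L pos → invEntry (bump j k) (map (shift j) L) pos ≡ invEntry k L pos
invEntry-map-shift j k []      pos = refl
invEntry-map-shift j k (x ∷ L) pos rewrite sgn-shift j x | invEntry-map-shift j k L (suc pos) =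
  cong (if_then sgn x ℤ.* + pos else invEntry k L (suc pos)) (does-⇔ sameMagnitude (∣ shift j x ∣ ≟ bump j k) (∣ x ∣ ≟ k))
  where
  sameMagnitude : ∣ shift j x ∣ ≡ bump j k ⇔ ∣ x ∣ ≡ k
  sameMagnitude = mk⇔ (λ e → bump-injective j (trans (sym (∣shift∣≡bump j x)) e))
                      (λ e → trans (∣shift∣≡bump j x) (cong (bump j) e))

invEntry-suc-start : ∀ k L {q p} → q ℕ.≤ p → invEntry k L (suc (suc p)) ≡ shift (suc q) (invEntry k L (suc p))
invEntry-suc-start k []      q≤p = refl
invEntry-suc-start k (x ∷ L) {q} {p} q≤p with ∣ x ∣ ≡ᵇ k
... | true  = sym (trans (shift-sgn*+ (suc q) x (suc p)) (cong (λ m → sgn x ℤ.* + m) (bump-above (s≤s q≤p))))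
... | false = invEntry-suc-start k L (ℕP.m≤n⇒m≤1+n q≤p)

invEntry-insert : ∀ k A v B p → ∣ v ∣ ≢ k →
  invEntry k (A ++ v ∷ B) (suc p) ≡ shift (suc p ℕ.+ length A) (invEntry k (A ++ B) (suc p))
invEntry-insert k []      v B p ∣v∣≢k with ∣ v ∣ ≡ᵇ k | proof (∣ v ∣ ≟ k)
... | true  | ofʸ ∣v∣≡k = contradiction ∣v∣≡k ∣v∣≢k
... | false | _         = invEntry-suc-start k B (ℕP.≤-reflexive (ℕP.+-identityʳ p))
invEntry-insert k (x ∷ A) v B p ∣v∣≢k with ∣ x ∣ ≡ᵇ k
... | true  = sym (trans (shift-sgn*+ (suc p ℕ.+ suc (length A)) x (suc p))
                         (cong (λ m → sgn x ℤ.* + m) (bump-below (s≤s (ℕP.m<m+n p (s≤s z≤n))))))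
... | false = trans (invEntry-insert k A v B (suc p) ∣v∣≢k)
                    (cong (λ r → shift r (invEntry k (A ++ B) (suc (suc p)))) (sym (ℕP.+-suc (suc p) (length A))))

applyUpTo-insert : ∀ {A : Set} (F G : ℕ → A) (h : A → A) c n → c ℕ.≤ n →
  (∀ k → k ℕ.< c → G k ≡ h (F k)) → (∀ k → c ℕ.≤ k → k ℕ.< n → G (suc k) ≡ h (F k)) →
  applyUpTo G (suc n) ≡ map h (take c (applyUpTo F n)) ++ G c ∷ map h (drop c (applyUpTo F n))
applyUpTo-insert F G h zero zero    _ _ _ = refl
applyUpTo-insert F G h zero (suc n) _ before after =
  cong (G 0 ∷_) (trans (applyUpTo-insert (F ∘ suc) (G ∘ suc) h zero n z≤n (λ _ ()) (λ k _ k<n → after (suc k) z≤n (s≤s k<n)))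
                       (cong (_∷ map h (applyUpTo (F ∘ suc) n)) (after 0 z≤n (s≤s z≤n))))
applyUpTo-insert F G h (suc c) (suc n) (s≤s c≤n) before after =
  cong₂ _∷_ (before 0 (s≤s z≤n))
    (applyUpTo-insert (F ∘ suc) (G ∘ suc) h c n c≤n (λ k k<c → before (suc k) (s≤s k<c))
                      (λ k c≤k k<n → after (suc k) (s≤s c≤k) (s≤s k<n)))

invB-insertAt : ∀ {n π} i' j' v → length π ≡ n → i' ℕ.≤ n → j' ℕ.≤ n → ∣ v ∣ ≡ suc j' →
  ∃[ w ] invB (suc n) (insertAt (suc i') (suc j') v π) ≡ insertAt (suc j') (suc i') w (invB n π)
invB-insertAt {n} {π} i' j' v len i'≤n j'≤n ∣v∣≡1+j' = G j' , (begin
  invB (suc n) σ                                      ≡⟨ map-upTo G (suc n) ⟩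
  applyUpTo G (suc n)                                 ≡⟨ applyUpTo-insert F G (shift (suc i')) j' n j'≤n before after ⟩
  insertAt (suc j') (suc i') (G j') (applyUpTo F n)   ≡⟨ cong (insertAt (suc j') (suc i') (G j')) (map-upTo F n) ⟨
  insertAt (suc j') (suc i') (G j') (invB n π)        ∎)
  where
  open ≡-Reasoning
  s = shift (suc j')
  σ = insertAt (suc i') (suc j') v π
  F G : ℕ → ℤ
  F k = invEntry (suc k) π 1
  G k = invEntry (suc k) σ 1
  A = map s (take i' π)
  B = map s (drop i' π)
  length-A : length A ≡ i'
  length-A = trans (length-map s (take i' π)) (trans (length-take i' π) (ℕP.m≤n⇒m⊓n≡m (subst (i' ℕ.≤_) (sym len) i'≤n)))
  A++B : A ++ B ≡ map s π
  A++B = trans (sym (map-++ s (take i' π) (drop i' π))) (cong (map s) (take++drop≡id i' π))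
  entry : ∀ m → invEntry (bump (suc j') m) σ 1 ≡ shift (suc i') (invEntry m π 1)
  entry m = begin
    invEntry (bump (suc j') m) σ 1                                 ≡⟨ invEntry-insert _ A v B 0 ∣v∣≢ ⟩
    shift (suc (length A)) (invEntry (bump (suc j') m) (A ++ B) 1) ≡⟨ cong₂ (λ r L → shift (suc r) (invEntry (bump (suc j') m) L 1)) length-A A++B ⟩
    shift (suc i') (invEntry (bump (suc j') m) (map s π) 1)       ≡⟨ cong (shift (suc i')) (invEntry-map-shift (suc j') m π 1) ⟩
    shift (suc i') (invEntry m π 1)                                ∎
    where
    ∣v∣≢ : ∣ v ∣ ≢ bump (suc j') m
    ∣v∣≢ e = bump≢threshold (suc j') m (trans (sym e) ∣v∣≡1+j')
  before : ∀ k → k ℕ.< j' → G k ≡ shift (suc i') (F k)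
  before k k<j' = subst (λ m → invEntry m σ 1 ≡ shift (suc i') (F k)) (bump-below (s≤s k<j')) (entry (suc k))
  after : ∀ k → j' ℕ.≤ k → k ℕ.< n → G (suc k) ≡ shift (suc i') (F k)
  after k j'≤k _ = subst (λ m → invEntry m σ 1 ≡ shift (suc i') (F k)) (bump-above (s≤s j'≤k)) (entry (suc k))

ides-insertAt : ∀ {n π} i' j' v → length π ≡ n → i' ℕ.≤ n → j' ℕ.≤ n → ∣ v ∣ ≡ suc j' →
  ZeroOrOneAbove (ides (suc n) (insertAt (suc i') (suc j') v π)) (ides n π)
ides-insertAt {n} {π} i' j' v len i'≤n j'≤n ∣v∣≡1+j' with invB-insertAt i' j' v len i'≤n j'≤n ∣v∣≡1+j'
... | w , invB-σ = subst (λ L → ZeroOrOneAbove (desB L) (ides n π)) (sym invB-σ) (desB-insertAt (suc j') i' w (invB n π))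

zeroOrOneAbove⇒difference : ∀ {a b} → ZeroOrOneAbove a b → (+ a ℤ.- + b ≡ 0ℤ) ⊎ (+ a ℤ.- + b ≡ 1ℤ)
zeroOrOneAbove⇒difference {b = b} (inj₁ refl) = inj₁ (ℤP.+-inverseʳ (+ b))
zeroOrOneAbove⇒difference {b = b} (inj₂ refl) =
  inj₂ (trans (ℤP.+-assoc 1ℤ (+ b) (ℤ.- + b)) (cong (λ z → 1ℤ ℤ.+ z) (ℤP.+-inverseʳ (+ b))))

allowedType : ∀ {a b c d} → ZeroOrOneAbove a b → ZeroOrOneAbove c d → AllowedType ((+ a ℤ.- + b) , (+ c ℤ.- + d))
allowedType s t with zeroOrOneAbove⇒difference s | zeroOrOneAbove⇒difference t
... | inj₁ x | inj₁ y = inj₁ (cong₂ _,_ x y)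
... | inj₂ x | inj₁ y = inj₂ (inj₁ (cong₂ _,_ x y))
... | inj₁ x | inj₂ y = inj₂ (inj₂ (inj₁ (cong₂ _,_ x y)))
... | inj₂ x | inj₂ y = inj₂ (inj₂ (inj₂ (cong₂ _,_ x y)))

proposition3p6 : (n : ℕ) (π : List ℤ) → IsSignedPerm n π →
    (i j : ℕ) → 1 ℕ.≤ i → i ℕ.≤ suc n → 1 ℕ.≤ j → j ℕ.≤ suc n →
    AllowedType (dPlus n π i j) × AllowedType (dMinus n π i j)
proposition3p6 n π (len , _) (suc i') (suc j') _ (s≤s i'≤n) _ (s≤s j'≤n) =
  allowedType (desB-insertAt (suc i') j' (+ suc j') π) (ides-insertAt i' j' (+ suc j') len i'≤n j'≤n refl) ,
  allowedType (desB-insertAt (suc i') j' (ℤ.- + suc j') π) (ides-insertAt i' j' (ℤ.- + suc j') len i'≤n j'≤n refl)
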